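{- The holomorphic solution $\widetilde{w}_3$ at the origin of the differential equation \begin{equation*} \Big(z(1-z)^2\partial_z^2+(1-3z)(1-z)\partial_z+z-\tfrac34\Big) w(z)=\frac12\, {}_2F_1\!\left(1,1;\frac32;z\right) \end{equation*} with the initial condition $\widetilde{w}_3(0)=0$ is given by \begin{equation*} \widetilde{w}_3(z) =-2\sum_{n=0}^\infty \left( \sum_{k=0}^n(-1)^k\binom{ -\frac12}{k}^{\!\!2}\binom{n}{k} \sum_{j=0}^{k-1} \frac{1}{(2j+1)^3}\binom{ -\frac12}{j}^{\!\!\!-2} \right)z^n. \end{equation*} In particular, \begin{equation*} \widetilde{J}_3(n)=-2\sum_{k=0}^n(-1)^k\binom{ -\frac12}{k}^{\!\!2}\binom{n}{k} \sum_{j=0}^{k-1} \frac{1}{(2j+1)^3}\binom{ -\frac12}{j}^{\!\!\!-2}. \end{equation*}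
   Context: Here ${}_2F_1$ is the Gauss hypergeometric function and $\partial_z=d/dz$. For $n\ge0$ let \begin{equation*} J_2(n) := \int_0^\infty\!\!\int_0^\infty \frac{e^{ -(t+s)/2}}{1-e^{ -(t+s)}}\left(\frac{(1-e^{ -2t})(1-e^{ -2s})}{(1-e^{ -(t+s)})^2}\right)^{\!n}dt\,ds, \end{equation*} \begin{equation*} J_3(n) := \int_0^\infty\!\!\int_0^\infty\!\!\int_0^\infty \frac{e^{ -(t+s+u)/2}}{1-e^{ -(t+s+u)}}\left(\frac{(1-e^{ -2t})(1-e^{ -2(s+u)})}{(1-e^{ -(t+s+u)})^2}\right)^{\!n}dt\,ds\,du, \end{equation*} and set $\widetilde{J}_2(n):=J_2(n)/J_2(0)$, $\widetilde{J}_3(n):=J_3(n)-J_3(0)\widetilde{J}_2(n)$. Equivalently, $\widetilde{J}_3(n)$ is determined by $\widetilde{J}_3(0)=0$, $\widetilde{J}_3(1)=\frac12$ and the recurrence $4n^2 \widetilde{J}_3(n)-(8n^2-8n+3)\widetilde{J}_3(n-1)+4(n-1)^2\widetilde{J}_3(n-2)=\frac{2^n(n-1)!}{(2n-1)!!}$ for $n\ge2$. Let $\widetilde{w}_3(z):=\sum_{n\ge0}\widetilde{J}_3(n)z^n$; it satisfies the inhomogeneous singly confluent Heun equation in the claim. (Any holomorphic solution at $0$ of that equation is $c\,\widetilde{w}_2+\widetilde{w}_3$ with $\widetilde{w}_2(z)=\sum_{n\ge0}\widetilde{J}_2(n)z^n$, which solves the corresponding homogeneous equation.) -}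

module Defs where

open import Data.Nat as ℕ using (ℕ; zero; suc)
open import Data.Integer as ℤ using (+_)
open import Data.Rational using (ℚ; 0ℚ; 1ℚ; _+_; _*_; _-_; -_; 1/_; _/_; ≢-nonZero)
open import Data.Rational.Properties using (_≟_)
open import Relation.Nullary using (yes; no)

ι : ℕ → ℚ
ι n = (+ n) / 1

-- total multiplicative inverse on ℚ (inv 0 = 0; only used at nonzero arguments)
inv : ℚ → ℚ
inv p with p ≟ 0ℚ
... | yes _  = 0ℚ
... | no p≢0 = 1/_ p {{≢-nonZero p≢0}}

sumTo : ℕ → (ℕ → ℚ) → ℚ
sumTo zero    f = f 0
sumTo (suc n) f = sumTo n f + f (suc n)

sumBelow : ℕ → (ℕ → ℚ) → ℚ
sumBelow zero    f = 0ℚ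
sumBelow (suc k) f = sumBelow k f + f k

prodBelow : ℕ → (ℕ → ℚ) → ℚ
prodBelow zero    f = 1ℚ
prodBelow (suc k) f = prodBelow k f * f k

poch : ℚ → ℕ → ℚ
poch x k = prodBelow k (λ i → x + ι i)

factℚ : ℕ → ℚ
factℚ k = prodBelow k (λ i → ι (suc i))

gbinom : ℚ → ℕ → ℚ
gbinom x k = prodBelow k (λ i → x - ι i) * inv (factℚ k)

binomℚ : ℕ → ℕ → ℚ
binomℚ n k = gbinom (ι n) k

powℚ : ℚ → ℕ → ℚ
powℚ x k = prodBelow k (λ _ → x)

-- (2n-1)!! = 1·3·…·(2n-1)  ((-1)!! = 1)
oddDoubleFact : ℕ → ℚ
oddDoubleFact n = prodBelow n (λ i → ι (2 ℕ.* i ℕ.+ 1))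

-- Formal power series over ℚ, represented by coefficient sequences:
-- w = Σ_n w n · z^n

Series : Set
Series = ℕ → ℚ

_⊕_ : Series → Series → Series
(a ⊕ b) n = a n + b n

_⊖_ : Series → Series → Series
(a ⊖ b) n = a n - b n

scale : ℚ → Series → Series
scale c a n = c * a n

mulZ : Series → Series
mulZ a zero    = 0ℚ
mulZ a (suc n) = a n

deriv : Series → Series
deriv a n = ι (suc n) * a (suc n)

oneMinusZ : Series → Series
oneMinusZ a = a ⊖ mulZ a

oneMinus3Z : Series → Series
oneMinus3Z a = a ⊖ scale (ι 3) (mulZ a)

hyp2F1 : ℚ → ℚ → ℚ → Series
hyp2F1 a b c m = poch a m * poch b m * inv (poch c m * factℚ m)

heunOp : Series → Series
heunOp w =
  (mulZ (oneMinusZ (oneMinusZ (deriv (deriv w)))) ⊕ oneMinus3Z (oneMinusZ (deriv w)))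
  ⊕ (mulZ w ⊖ scale ((+ 3) / 4) w)

heunRHS : Series
heunRHS = scale ((+ 1) / 2) (hyp2F1 1ℚ 1ℚ ((+ 3) / 2))

-- J̃_3(n), defined by the recurrence from the context:
--  J̃3(0)=0, J̃3(1)=1/2,
--  4n² J̃3(n) - (8n²-8n+3) J̃3(n-1) + 4(n-1)² J̃3(n-2) = 2^n (n-1)! / (2n-1)!!  (n ≥ 2)
J̃₃ : ℕ → ℚ
J̃₃ zero = 0ℚ
J̃₃ (suc zero) = (+ 1) / 2
J̃₃ (suc (suc m)) =
  let n = suc (suc m) in
  inv (ι (4 ℕ.* n ℕ.* n)) *
    ( powℚ (ι 2) n * factℚ (suc m) * inv (oddDoubleFact n)
    + ι (8 ℕ.* n ℕ.* n ℕ.∸ 8 ℕ.* n ℕ.+ 3) * J̃₃ (suc m)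
    - ι (4 ℕ.* suc m ℕ.* suc m) * J̃₃ m )

formulaCoeff : ℕ → ℚ
formulaCoeff n =
  - ι 2 * sumTo n (λ k →
      powℚ (- 1ℚ) k * powℚ (gbinom (- ((+ 1) / 2)) k) 2 * binomℚ n k *
      sumBelow k (λ j → inv (powℚ (ι (2 ℕ.* j ℕ.+ 1)) 3) * inv (powℚ (gbinom (- ((+ 1) / 2)) j) 2)))

{-# OPTIONS --safe #-}

-- The explicit coefficients are the binomial transform A(n) = Σₖ C(n,k) b(k) of
-- b(k) = -2 (-1)ᵏ C(-½,k)² Σ_{j<k} (2j+1)⁻³ C(-½,j)⁻².  By Pascal's rule and absorption,
-- k C(n,k) = n C(n-1,k-1), the binomial transform turns four times the Heun operator into the
-- first-order operator 4(k+1)² b(k+1) + (2k+1)² b(k).  As 2(k+1) C(-½,k+1) = -(2k+1) C(-½,k),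
-- this operator kills the partial sums in b(k) and leaves 2 (-1)ᵏ/(2k+1), whose binomial
-- transform, like 2ⁿ⁺¹ n!/(2n+1)!! and the coefficients of ₂F₁(1,1;3/2;z), satisfies
-- (2n+3) X(n+1) = 2(n+1) X(n).  The coefficient recurrence of the Heun equation has leading
-- coefficient (n+2)², so a solution is determined by its value at 0; J̃₃ is defined by four
-- times that recurrence.

module Submission where

open import Defs
open import Data.Nat as ℕ using (ℕ; zero; suc)
import Data.Nat.Properties as ℕ
open import Data.Nat.Coprimality using (1-coprimeTo) renaming (sym to coprime-sym)
open import Data.Integer as ℤ using (+_)
import Data.Integer.Properties as ℤ
open import Data.Rational
  using (ℚ; 0ℚ; 1ℚ; ½; _+_; _*_; _-_; -_; 1/_; _/_; mkℚ; ↥_; ≢-nonZero; NonNegative; Positive)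
open import Data.Rational.Properties
  using ( _≟_; normalize-coprime; +-*-commutativeRing; pos+nonNeg⇒pos; positive⁻¹; <⇒≢
        ; *-inverseˡ; *-comm; *-assoc; *-identityˡ; *-identityʳ; *-zeroˡ; *-zeroʳ; *-distribˡ-+; *-distribʳ-+
        ; +-assoc; +-identityˡ)
open import Data.Product using (_×_; _,_; proj₁)
open import Function using (_∘_)
open import Level using (0ℓ)
open import Relation.Nullary using (Dec; yes; no; contradiction)
open import Relation.Nullary.Decidable using (dec⇒maybe)
open import Relation.Binary.PropositionalEquality
open import Tactic.RingSolver using (solve-∀)
open import Tactic.RingSolver.Core.AlmostCommutativeRing using (AlmostCommutativeRing; fromCommutativeRing)

open ≡-Reasoning

ℚ-ring : AlmostCommutativeRing 0ℓ 0ℓ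
ℚ-ring = fromCommutativeRing +-*-commutativeRing (λ p → dec⇒maybe (0ℚ ≟ p))

¾ : ℚ
¾ = + 3 / 4

ι≡mkℚ : ∀ n → ι n ≡ mkℚ (+ n) 0 (coprime-sym (1-coprimeTo n))
ι≡mkℚ n = normalize-coprime (coprime-sym (1-coprimeTo n))

ι-+ : ∀ m n → ι (m ℕ.+ n) ≡ ι m + ι n
ι-+ m n rewrite ι≡mkℚ m | ι≡mkℚ n =
  cong (_/ 1) (sym (cong₂ ℤ._+_ (ℤ.*-identityʳ (+ m)) (ℤ.*-identityʳ (+ n))))

ι-* : ∀ m n → ι (m ℕ.* n) ≡ ι m * ι n
ι-* m n rewrite ι≡mkℚ m | ι≡mkℚ n = cong (_/ 1) (ℤ.pos-* m n)

ι-suc : ∀ n → ι (suc n) ≡ 1ℚ + ι n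
ι-suc = ι-+ 1

ι-odd : ∀ k → ι (2 ℕ.* k ℕ.+ 1) ≡ ι 2 * ι k + 1ℚ
ι-odd k = trans (ι-+ (2 ℕ.* k) 1) (cong (_+ 1ℚ) (ι-* 2 k))

ι≢0 : ∀ n .{{_ : ℕ.NonZero n}} → ι n ≢ 0ℚ
ι≢0 n ιn≡0 = ℕ.≢-nonZero⁻¹ n (ℤ.+-injective (cong ↥_ (trans (sym (ι≡mkℚ n)) ιn≡0)))

ι-odd≢0 : ∀ k → ι (2 ℕ.* k ℕ.+ 1) ≢ 0ℚ
ι-odd≢0 k = subst (λ m → ι m ≢ 0ℚ) (ℕ.+-comm 1 (2 ℕ.* k)) (ι≢0 (suc (2 ℕ.* k)))

ι-nonNegative : ∀ n → NonNegative (ι n)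
ι-nonNegative n rewrite ι≡mkℚ n = _

positive+ι≢0 : ∀ p n .{{_ : Positive p}} → p + ι n ≢ 0ℚ
positive+ι≢0 p n = ≢-sym (<⇒≢ (positive⁻¹ (p + ι n) {{pos+nonNeg⇒pos p (ι n) {{ι-nonNegative n}}}}))

inv≡1/ : ∀ {p} (p≢0 : p ≢ 0ℚ) → inv p ≡ (1/ p) {{≢-nonZero p≢0}}
inv≡1/ {p} p≢0 with p ≟ 0ℚ
... | yes p≡0 = contradiction p≡0 p≢0
... | no _    = refl

inv-inverseˡ : ∀ {p} → p ≢ 0ℚ → inv p * p ≡ 1ℚ
inv-inverseˡ {p} p≢0 = trans (cong (_* p) (inv≡1/ p≢0)) (*-inverseˡ p {{≢-nonZero p≢0}})

inv-inverseʳ : ∀ {p} → p ≢ 0ℚ → p * inv p ≡ 1ℚ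
inv-inverseʳ {p} p≢0 = trans (*-comm p (inv p)) (inv-inverseˡ p≢0)

inv-cancelˡ : ∀ {r} → r ≢ 0ℚ → ∀ p → inv r * (r * p) ≡ p
inv-cancelˡ {r} r≢0 p = begin
  inv r * (r * p)  ≡⟨ *-assoc (inv r) r p ⟨
  inv r * r * p    ≡⟨ cong (_* p) (inv-inverseˡ r≢0) ⟩
  1ℚ * p           ≡⟨ *-identityˡ p ⟩
  p                ∎

inv-cancelʳ : ∀ {r} → r ≢ 0ℚ → ∀ p → r * (inv r * p) ≡ p
inv-cancelʳ {r} r≢0 p = begin
  r * (inv r * p)  ≡⟨ *-assoc r (inv r) p ⟨
  r * inv r * p    ≡⟨ cong (_* p) (inv-inverseʳ r≢0) ⟩
  1ℚ * p           ≡⟨ *-identityˡ p ⟩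
  p                ∎

*-cancelˡ-≢0 : ∀ {r p q} → r ≢ 0ℚ → r * p ≡ r * q → p ≡ q
*-cancelˡ-≢0 {r} {p} {q} r≢0 rp≡rq = begin
  p                ≡⟨ inv-cancelˡ r≢0 p ⟨
  inv r * (r * p)  ≡⟨ cong (inv r *_) rp≡rq ⟩
  inv r * (r * q)  ≡⟨ inv-cancelˡ r≢0 q ⟩
  q                ∎

*-≢0 : ∀ {p q} → p ≢ 0ℚ → q ≢ 0ℚ → p * q ≢ 0ℚ
*-≢0 {p} {q} p≢0 q≢0 pq≡0 = q≢0 (begin
  q                ≡⟨ inv-cancelˡ p≢0 q ⟨
  inv p * (p * q)  ≡⟨ cong (inv p *_) pq≡0 ⟩
  inv p * 0ℚ       ≡⟨ *-zeroʳ (inv p) ⟩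
  0ℚ               ∎)

inv-unique : ∀ {p q} → p * q ≡ 1ℚ → inv p ≡ q
inv-unique {p} {q} pq≡1 = begin
  inv p             ≡⟨ *-identityʳ (inv p) ⟨
  inv p * 1ℚ        ≡⟨ cong (inv p *_) pq≡1 ⟨
  inv p * (p * q)   ≡⟨ inv-cancelˡ p≢0 q ⟩
  q                 ∎
  where
  p≢0 : p ≢ 0ℚ
  p≢0 refl with trans (sym pq≡1) (*-zeroˡ q)
  ... | ()

-- No hypotheses are needed because inv 0ℚ = 0ℚ.
inv-distrib-* : ∀ p q → inv (p * q) ≡ inv p * inv q
inv-distrib-* p q = by-cases (p ≟ 0ℚ) (q ≟ 0ℚ)
  where
  interchange : ∀ a b c d → a * b * (c * d) ≡ a * c * (b * d)
  interchange = solve-∀ ℚ-ring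
  by-cases : Dec (p ≡ 0ℚ) → Dec (q ≡ 0ℚ) → inv (p * q) ≡ inv p * inv q
  by-cases (yes p≡0) _ = begin
    inv (p * q)    ≡⟨ cong (λ t → inv (t * q)) p≡0 ⟩
    inv (0ℚ * q)   ≡⟨ cong inv (*-zeroˡ q) ⟩
    0ℚ             ≡⟨ *-zeroˡ (inv q) ⟨
    0ℚ * inv q     ≡⟨ cong (λ t → inv t * inv q) p≡0 ⟨
    inv p * inv q  ∎
  by-cases _ (yes q≡0) = begin
    inv (p * q)    ≡⟨ cong (λ t → inv (p * t)) q≡0 ⟩
    inv (p * 0ℚ)   ≡⟨ cong inv (*-zeroʳ p) ⟩
    0ℚ             ≡⟨ *-zeroʳ (inv p) ⟨
    inv p * 0ℚ     ≡⟨ cong (λ t → inv p * inv t) q≡0 ⟨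
    inv p * inv q  ∎
  by-cases (no p≢0) (no q≢0) = inv-unique {p * q} (begin
    p * q * (inv p * inv q)  ≡⟨ interchange p q (inv p) (inv q) ⟩
    p * inv p * (q * inv q)  ≡⟨ cong₂ _*_ (inv-inverseʳ p≢0) (inv-inverseʳ q≢0) ⟩
    1ℚ                       ∎)

inv-powℚ : ∀ x k → inv (powℚ x k) ≡ powℚ (inv x) k
inv-powℚ x zero    = refl
inv-powℚ x (suc k) = trans (inv-distrib-* (powℚ x k) x) (cong (_* inv x) (inv-powℚ x k))

cancel-inv-factor : ∀ {s} a b → s ≢ 0ℚ → s * (a * inv (b * s)) ≡ a * inv b
cancel-inv-factor {s} a b s≢0 = begin
  s * (a * inv (b * s))         ≡⟨ cong (λ t → s * (a * t)) (inv-distrib-* b s) ⟩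
  s * (a * (inv b * inv s))     ≡⟨ regroup s a (inv b) (inv s) ⟩
  s * inv s * (a * inv b)       ≡⟨ cong (_* (a * inv b)) (inv-inverseʳ s≢0) ⟩
  1ℚ * (a * inv b)              ≡⟨ *-identityˡ (a * inv b) ⟩
  a * inv b                     ∎
  where
  regroup : ∀ s a b t → s * (a * (b * t)) ≡ s * t * (a * b)
  regroup = solve-∀ ℚ-ring

-- Binomial coefficients and the binomial transform

sumTo-cong : ∀ n {f g : ℕ → ℚ} → (∀ k → f k ≡ g k) → sumTo n f ≡ sumTo n g
sumTo-cong zero    f≗g = f≗g 0
sumTo-cong (suc n) f≗g = cong₂ _+_ (sumTo-cong n f≗g) (f≗g (suc n))

sumTo-+ : ∀ n (f g : ℕ → ℚ) → sumTo n (λ k → f k + g k) ≡ sumTo n f + sumTo n g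
sumTo-+ zero    f g = refl
sumTo-+ (suc n) f g =
  trans (cong (_+ (f (suc n) + g (suc n))) (sumTo-+ n f g)) (interchange (sumTo n f) (sumTo n g) (f (suc n)) (g (suc n)))
  where
  interchange : ∀ a b c d → a + b + (c + d) ≡ a + c + (b + d)
  interchange = solve-∀ ℚ-ring

sumTo-*ˡ : ∀ n c (f : ℕ → ℚ) → sumTo n (λ k → c * f k) ≡ c * sumTo n f
sumTo-*ˡ zero    c f = refl
sumTo-*ˡ (suc n) c f =
  trans (cong (_+ c * f (suc n)) (sumTo-*ˡ n c f)) (sym (*-distribˡ-+ c (sumTo n f) (f (suc n))))

sumTo-suc : ∀ n (f : ℕ → ℚ) → sumTo (suc n) f ≡ f 0 + sumTo n (f ∘ suc)
sumTo-suc zero    f = refl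
sumTo-suc (suc n) f =
  trans (cong (_+ f (suc (suc n))) (sumTo-suc n f)) (+-assoc (f 0) (sumTo n (f ∘ suc)) (f (suc (suc n))))

fallingFactorial : ℚ → ℕ → ℚ
fallingFactorial x k = prodBelow k (λ i → x - ι i)

fallingFactorial-suc : ∀ x k → fallingFactorial (1ℚ + x) (suc k) ≡ (1ℚ + x) * fallingFactorial x k
fallingFactorial-suc x zero    = identity x
  where
  identity : ∀ x → 1ℚ * (1ℚ + x - ι 0) ≡ (1ℚ + x) * 1ℚ
  identity = solve-∀ ℚ-ring
fallingFactorial-suc x (suc k) = begin
  fallingFactorial (1ℚ + x) (suc k) * (1ℚ + x - ι (suc k))
    ≡⟨ cong₂ (λ F i → F * (1ℚ + x - i)) (fallingFactorial-suc x k) (ι-suc k) ⟩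
  (1ℚ + x) * F * (1ℚ + x - (1ℚ + ι k))
    ≡⟨ identity x F (ι k) ⟩
  (1ℚ + x) * (F * (x - ι k))
    ∎
  where
  F : ℚ
  F = fallingFactorial x k
  identity : ∀ x F u → (1ℚ + x) * F * (1ℚ + x - (1ℚ + u)) ≡ (1ℚ + x) * (F * (x - u))
  identity = solve-∀ ℚ-ring

gbinom-suc : ∀ x k → ι (suc k) * gbinom x (suc k) ≡ (x - ι k) * gbinom x k
gbinom-suc x k = begin
  ι (suc k) * (F * (x - ι k) * inv (factℚ k * ι (suc k)))
    ≡⟨ cancel-inv-factor (F * (x - ι k)) (factℚ k) (ι≢0 (suc k)) ⟩
  F * (x - ι k) * inv (factℚ k)
    ≡⟨ identity F (x - ι k) (inv (factℚ k)) ⟩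
  (x - ι k) * (F * inv (factℚ k))
    ∎
  where
  F : ℚ
  F = fallingFactorial x k
  identity : ∀ F d r → F * d * r ≡ d * (F * r)
  identity = solve-∀ ℚ-ring

gbinom-absorb : ∀ x k → ι (suc k) * gbinom (1ℚ + x) (suc k) ≡ (1ℚ + x) * gbinom x k
gbinom-absorb x k = begin
  ι (suc k) * (fallingFactorial (1ℚ + x) (suc k) * inv (factℚ k * ι (suc k)))
    ≡⟨ cancel-inv-factor (fallingFactorial (1ℚ + x) (suc k)) (factℚ k) (ι≢0 (suc k)) ⟩
  fallingFactorial (1ℚ + x) (suc k) * inv (factℚ k)
    ≡⟨ cong (_* inv (factℚ k)) (fallingFactorial-suc x k) ⟩
  (1ℚ + x) * fallingFactorial x k * inv (factℚ k)
    ≡⟨ *-assoc (1ℚ + x) _ _ ⟩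
  (1ℚ + x) * gbinom x k
    ∎

gbinom-pascal : ∀ x k → gbinom (1ℚ + x) (suc k) ≡ gbinom x k + gbinom x (suc k)
gbinom-pascal x k = *-cancelˡ-≢0 (ι≢0 (suc k)) (begin
  ι (suc k) * gbinom (1ℚ + x) (suc k)             ≡⟨ gbinom-absorb x k ⟩
  (1ℚ + x) * G                                     ≡⟨ identity x (ι k) G ⟩
  (1ℚ + ι k) * G + (x - ι k) * G                   ≡⟨ cong₂ _+_ (cong (_* G) (ι-suc k)) (gbinom-suc x k) ⟨
  ι (suc k) * G + ι (suc k) * gbinom x (suc k)     ≡⟨ *-distribˡ-+ (ι (suc k)) G _ ⟨
  ι (suc k) * (G + gbinom x (suc k))               ∎)
  where
  G : ℚ
  G = gbinom x k
  identity : ∀ x u G → (1ℚ + x) * G ≡ (1ℚ + u) * G + (x - u) * G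
  identity = solve-∀ ℚ-ring

binomℚ-pascal : ∀ n k → binomℚ (suc n) (suc k) ≡ binomℚ n k + binomℚ n (suc k)
binomℚ-pascal n k = trans (cong (λ x → gbinom x (suc k)) (ι-suc n)) (gbinom-pascal (ι n) k)

binomℚ-absorb : ∀ n k → ι (suc k) * binomℚ (suc n) (suc k) ≡ ι (suc n) * binomℚ n k
binomℚ-absorb n k = begin
  ι (suc k) * gbinom (ι (suc n)) (suc k)   ≡⟨ cong (λ x → ι (suc k) * gbinom x (suc k)) (ι-suc n) ⟩
  ι (suc k) * gbinom (1ℚ + ι n) (suc k)    ≡⟨ gbinom-absorb (ι n) k ⟩
  (1ℚ + ι n) * binomℚ n k                  ≡⟨ cong (_* binomℚ n k) (ι-suc n) ⟨
  ι (suc n) * binomℚ n k                   ∎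

binomℚ[n,1+n]≡0 : ∀ n → binomℚ n (suc n) ≡ 0ℚ
binomℚ[n,1+n]≡0 n = vanishes (fallingFactorial (ι n) n) (ι n) (inv (factℚ (suc n)))
  where
  vanishes : ∀ F x r → F * (x - x) * r ≡ 0ℚ
  vanishes = solve-∀ ℚ-ring

binomialTransform : (ℕ → ℚ) → ℕ → ℚ
binomialTransform f n = sumTo n (λ k → binomℚ n k * f k)

timesIndex : (ℕ → ℚ) → ℕ → ℚ
timesIndex f k = ι k * f k

binomialTransform-cong : ∀ {f g : ℕ → ℚ} → (∀ k → f k ≡ g k) → ∀ n → binomialTransform f n ≡ binomialTransform g n
binomialTransform-cong f≗g n = sumTo-cong n (λ k → cong (binomℚ n k *_) (f≗g k))

binomialTransform-+ : ∀ (f g : ℕ → ℚ) n →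
  binomialTransform (λ k → f k + g k) n ≡ binomialTransform f n + binomialTransform g n
binomialTransform-+ f g n = trans (sumTo-cong n (λ k → *-distribˡ-+ (binomℚ n k) (f k) (g k))) (sumTo-+ n _ _)

binomialTransform-*ˡ : ∀ c (f : ℕ → ℚ) n → binomialTransform (λ k → c * f k) n ≡ c * binomialTransform f n
binomialTransform-*ˡ c f n = trans (sumTo-cong n (λ k → swap (binomℚ n k) c (f k))) (sumTo-*ˡ n c _)
  where
  swap : ∀ b c x → b * (c * x) ≡ c * (b * x)
  swap = solve-∀ ℚ-ring

binomialTransform-suc : ∀ (f : ℕ → ℚ) n →
  binomialTransform f (suc n) ≡ binomialTransform f n + binomialTransform (f ∘ suc) n
binomialTransform-suc f n = begin
  binomialTransform f (suc n)
    ≡⟨ sumTo-suc n _ ⟩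
  1ℚ * f 0 + sumTo n (λ k → binomℚ (suc n) (suc k) * f (suc k))
    ≡⟨ cong (_+_ (1ℚ * f 0)) (sumTo-cong n pascal) ⟩
  1ℚ * f 0 + sumTo n (λ k → binomℚ n k * f (suc k) + binomℚ n (suc k) * f (suc k))
    ≡⟨ cong (_+_ (1ℚ * f 0)) (sumTo-+ n _ _) ⟩
  1ℚ * f 0 + (binomialTransform (f ∘ suc) n + tail)
    ≡⟨ regroup (1ℚ * f 0) _ tail ⟩
  (1ℚ * f 0 + tail) + binomialTransform (f ∘ suc) n
    ≡⟨ cong (_+ binomialTransform (f ∘ suc) n) split ⟨
  binomialTransform f n + binomialTransform (f ∘ suc) n
    ∎
  where
  tail : ℚ
  tail = sumTo n (λ k → binomℚ n (suc k) * f (suc k))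
  pascal : ∀ k → binomℚ (suc n) (suc k) * f (suc k) ≡ binomℚ n k * f (suc k) + binomℚ n (suc k) * f (suc k)
  pascal k = trans (cong (_* f (suc k)) (binomℚ-pascal n k)) (*-distribʳ-+ (f (suc k)) (binomℚ n k) (binomℚ n (suc k)))
  regroup : ∀ a b c → a + (b + c) ≡ (a + c) + b
  regroup = solve-∀ ℚ-ring
  split : binomialTransform f n ≡ 1ℚ * f 0 + tail
  split = begin
    binomialTransform f n                   ≡⟨ extend (binomialTransform f n) (f (suc n)) ⟩
    binomialTransform f n + 0ℚ * f (suc n)  ≡⟨ cong (λ b → binomialTransform f n + b * f (suc n)) (binomℚ[n,1+n]≡0 n) ⟨
    sumTo (suc n) (λ k → binomℚ n k * f k)  ≡⟨ sumTo-suc n _ ⟩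
    1ℚ * f 0 + tail                         ∎
    where
    extend : ∀ s x → s ≡ s + 0ℚ * x
    extend = solve-∀ ℚ-ring

binomialTransform-timesIndex-zero : ∀ (f : ℕ → ℚ) → binomialTransform (timesIndex f) 0 ≡ 0ℚ
binomialTransform-timesIndex-zero f = cong (1ℚ *_) (*-zeroˡ (f 0))

binomialTransform-timesIndex-suc : ∀ (f : ℕ → ℚ) n →
  binomialTransform (timesIndex f) (suc n) ≡ ι (suc n) * binomialTransform (f ∘ suc) n
binomialTransform-timesIndex-suc f n = begin
  binomialTransform (timesIndex f) (suc n)
    ≡⟨ sumTo-suc n _ ⟩
  1ℚ * (0ℚ * f 0) + sumTo n (λ k → binomℚ (suc n) (suc k) * (ι (suc k) * f (suc k)))
    ≡⟨ cong₂ _+_ (cong (1ℚ *_) (*-zeroˡ (f 0))) (sumTo-cong n absorbed) ⟩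
  0ℚ + sumTo n (λ k → ι (suc n) * (binomℚ n k * f (suc k)))
    ≡⟨ +-identityˡ _ ⟩
  sumTo n (λ k → ι (suc n) * (binomℚ n k * f (suc k)))
    ≡⟨ sumTo-*ˡ n (ι (suc n)) _ ⟩
  ι (suc n) * binomialTransform (f ∘ suc) n
    ∎
  where
  swap : ∀ b i x → b * (i * x) ≡ i * b * x
  swap = solve-∀ ℚ-ring
  absorbed : ∀ k → binomℚ (suc n) (suc k) * (ι (suc k) * f (suc k)) ≡ ι (suc n) * (binomℚ n k * f (suc k))
  absorbed k = begin
    binomℚ (suc n) (suc k) * (ι (suc k) * f (suc k))   ≡⟨ swap (binomℚ (suc n) (suc k)) (ι (suc k)) (f (suc k)) ⟩
    ι (suc k) * binomℚ (suc n) (suc k) * f (suc k)     ≡⟨ cong (_* f (suc k)) (binomℚ-absorb n k) ⟩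
    ι (suc n) * binomℚ n k * f (suc k)                 ≡⟨ *-assoc (ι (suc n)) (binomℚ n k) (f (suc k)) ⟩
    ι (suc n) * (binomℚ n k * f (suc k))               ∎

binomialTransform-timesIndex-difference : ∀ (f : ℕ → ℚ) n →
  binomialTransform (timesIndex f) (suc n) ≡ ι (suc n) * (binomialTransform f (suc n) - binomialTransform f n)
binomialTransform-timesIndex-difference f n = begin
  binomialTransform (timesIndex f) (suc n)
    ≡⟨ binomialTransform-timesIndex-suc f n ⟩
  ι (suc n) * binomialTransform (f ∘ suc) n
    ≡⟨ cong (ι (suc n) *_) (difference (binomialTransform f n) (binomialTransform (f ∘ suc) n)) ⟩
  ι (suc n) * (binomialTransform f n + binomialTransform (f ∘ suc) n - binomialTransform f n)
    ≡⟨ cong (λ t → ι (suc n) * (t - binomialTransform f n)) (binomialTransform-suc f n) ⟨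
  ι (suc n) * (binomialTransform f (suc n) - binomialTransform f n)
    ∎
  where
  difference : ∀ a b → b ≡ a + b - a
  difference = solve-∀ ℚ-ring

-- The Heun operator

heunStencil : ℚ → ℚ → ℚ → ℚ → ℚ
heunStencil x a b c = (1ℚ + x) * (1ℚ + x) * c - (ι 2 * x * x + ι 2 * x + ¾) * b + x * x * a

heunOp-zero : ∀ w → heunOp w 0 ≡ w 1 - ¾ * w 0
heunOp-zero w = identity (w 0) (w 1)
  where
  identity : ∀ a b → (0ℚ + ((ι 1 * b - 0ℚ) - ι 3 * 0ℚ)) + (0ℚ - ¾ * a) ≡ b - ¾ * a
  identity = solve-∀ ℚ-ring

heunOp-suc : ∀ w n → heunOp w (suc n) ≡ heunStencil (ι (suc n)) (w n) (w (suc n)) (w (suc (suc n)))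
heunOp-suc w zero = identity (w 0) (w 1) (w 2)
  where
  identity : ∀ a b c →
    ((ι 1 * (ι 2 * c) - 0ℚ) - 0ℚ + ((ι 2 * c - ι 1 * b) - ι 3 * (ι 1 * b - 0ℚ))) + (a - ¾ * b)
      ≡ (1ℚ + ι 1) * (1ℚ + ι 1) * c - (ι 2 * ι 1 * ι 1 + ι 2 * ι 1 + ¾) * b + ι 1 * ι 1 * a
  identity = solve-∀ ℚ-ring
heunOp-suc w (suc zero) = identity (w 1) (w 2) (w 3)
  where
  identity : ∀ a b c →
    ((ι 2 * (ι 3 * c) - ι 1 * (ι 2 * b)) - (ι 1 * (ι 2 * b) - 0ℚ) + ((ι 3 * c - ι 2 * b) - ι 3 * (ι 2 * b - ι 1 * a)))
      + (a - ¾ * b)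
      ≡ (1ℚ + ι 2) * (1ℚ + ι 2) * c - (ι 2 * ι 2 * ι 2 + ι 2 * ι 2 + ¾) * b + ι 2 * ι 2 * a
  identity = solve-∀ ℚ-ring
heunOp-suc w (suc (suc q)) =
  unfolded (ι (suc q)) _ _ _ (w (suc (suc q))) (w (suc (suc (suc q)))) (w (suc (suc (suc (suc q)))))
           (ι-suc (suc q)) (ι-suc (suc (suc q))) (ι-suc (suc (suc (suc q))))
  where
  -- The left-hand side is heunOp unfolded, with yᵢ = ι (i + q).
  unfolded : ∀ y₁ y₂ y₃ y₄ a b c → y₂ ≡ 1ℚ + y₁ → y₃ ≡ 1ℚ + y₂ → y₄ ≡ 1ℚ + y₃ →
    (((y₃ * (y₄ * c) - y₂ * (y₃ * b)) - (y₂ * (y₃ * b) - y₁ * (y₂ * a)))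
      + ((y₄ * c - y₃ * b) - ι 3 * (y₃ * b - y₂ * a)))
      + (a - ¾ * b)
      ≡ heunStencil y₃ a b c
  unfolded y _ _ _ a b c refl refl refl = identity y a b c
    where
    identity : ∀ y a b c → let y₂ = 1ℚ + y ; y₃ = 1ℚ + y₂ ; y₄ = 1ℚ + y₃ in
      (((y₃ * (y₄ * c) - y₂ * (y₃ * b)) - (y₂ * (y₃ * b) - y * (y₂ * a)))
        + ((y₄ * c - y₃ * b) - ι 3 * (y₃ * b - y₂ * a)))
        + (a - ¾ * b)
        ≡ (1ℚ + y₃) * (1ℚ + y₃) * c - (ι 2 * y₃ * y₃ + ι 2 * y₃ + ¾) * b + y₃ * y₃ * a
    identity = solve-∀ ℚ-ring

heunOp-cong : ∀ {w v : Series} → (∀ k → w k ≡ v k) → ∀ n → heunOp w n ≡ heunOp v n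
heunOp-cong {w} {v} w≗v zero = begin
  heunOp w 0       ≡⟨ heunOp-zero w ⟩
  w 1 - ¾ * w 0    ≡⟨ cong₂ (λ a b → b - ¾ * a) (w≗v 0) (w≗v 1) ⟩
  v 1 - ¾ * v 0    ≡⟨ heunOp-zero v ⟨
  heunOp v 0       ∎
heunOp-cong {w} {v} w≗v (suc n) = begin
  heunOp w (suc n)
    ≡⟨ heunOp-suc w n ⟩
  heunStencil x (w n) (w (suc n)) (w (suc (suc n)))
    ≡⟨ cong₂ (heunStencil x (w n)) (w≗v (suc n)) (w≗v (suc (suc n))) ⟩
  heunStencil x (w n) (v (suc n)) (v (suc (suc n)))
    ≡⟨ cong (λ a → heunStencil x a (v (suc n)) (v (suc (suc n)))) (w≗v n) ⟩
  heunStencil x (v n) (v (suc n)) (v (suc (suc n)))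
    ≡⟨ heunOp-suc v n ⟨
  heunOp v (suc n)
    ∎
  where
  x : ℚ
  x = ι (suc n)

heunOp-zero-solve : ∀ w → w 1 ≡ heunOp w 0 + ¾ * w 0
heunOp-zero-solve w = trans (identity (w 0) (w 1)) (cong (_+ ¾ * w 0) (sym (heunOp-zero w)))
  where
  identity : ∀ a b → b ≡ (b - ¾ * a) + ¾ * a
  identity = solve-∀ ℚ-ring

heunOp-suc-solve : ∀ w n → let x = ι (suc n) in
  (1ℚ + x) * (1ℚ + x) * w (suc (suc n)) ≡ heunOp w (suc n) + (ι 2 * x * x + ι 2 * x + ¾) * w (suc n) - x * x * w n
heunOp-suc-solve w n =
  trans (identity x (w n) (w (suc n)) (w (suc (suc n))))
        (cong (λ h → h + (ι 2 * x * x + ι 2 * x + ¾) * w (suc n) - x * x * w n) (sym (heunOp-suc w n)))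
  where
  x : ℚ
  x = ι (suc n)
  identity : ∀ x a b c → (1ℚ + x) * (1ℚ + x) * c
    ≡ ((1ℚ + x) * (1ℚ + x) * c - (ι 2 * x * x + ι 2 * x + ¾) * b + x * x * a) + (ι 2 * x * x + ι 2 * x + ¾) * b - x * x * a
  identity = solve-∀ ℚ-ring

heunOp-unique : ∀ {w v : Series} → (∀ n → heunOp w n ≡ heunOp v n) → w 0 ≡ v 0 → ∀ n → w n ≡ v n
heunOp-unique {w} {v} same w₀≡v₀ n = proj₁ (consecutive n)
  where
  consecutive : ∀ n → w n ≡ v n × w (suc n) ≡ v (suc n)
  consecutive zero = w₀≡v₀ , (begin
    w 1                      ≡⟨ heunOp-zero-solve w ⟩
    heunOp w 0 + ¾ * w 0     ≡⟨ cong₂ (λ h a → h + ¾ * a) (same 0) w₀≡v₀ ⟩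
    heunOp v 0 + ¾ * v 0     ≡⟨ heunOp-zero-solve v ⟨
    v 1                      ∎)
  consecutive (suc n) with consecutive n
  ... | wₙ≡vₙ , wₙ₊₁≡vₙ₊₁ = wₙ₊₁≡vₙ₊₁ , *-cancelˡ-≢0 (*-≢0 leading≢0 leading≢0) (begin
    (1ℚ + x) * (1ℚ + x) * w (suc (suc n))
      ≡⟨ heunOp-suc-solve w n ⟩
    heunOp w (suc n) + m * w (suc n) - x * x * w n
      ≡⟨ cong₂ (λ h b → h + m * b - x * x * w n) (same (suc n)) wₙ₊₁≡vₙ₊₁ ⟩
    heunOp v (suc n) + m * v (suc n) - x * x * w n
      ≡⟨ cong (λ a → heunOp v (suc n) + m * v (suc n) - x * x * a) wₙ≡vₙ ⟩
    heunOp v (suc n) + m * v (suc n) - x * x * v n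
      ≡⟨ heunOp-suc-solve v n ⟨
    (1ℚ + x) * (1ℚ + x) * v (suc (suc n))
      ∎)
    where
    x m : ℚ
    x = ι (suc n)
    m = ι 2 * x * x + ι 2 * x + ¾
    leading≢0 : 1ℚ + x ≢ 0ℚ
    leading≢0 = positive+ι≢0 1ℚ (suc n)

heunOp-zero-differences : ∀ a₀ a₁ d₀ d₁ → d₀ ≡ 0ℚ → d₁ ≡ ι 1 * (a₁ - a₀) →
  ι 4 * (a₁ - ¾ * a₀) ≡ ι 4 * (ι 1 * (d₁ - d₀) + d₀) + a₀
heunOp-zero-differences a₀ a₁ _ _ refl refl = identity a₀ a₁
  where
  identity : ∀ a₀ a₁ → ι 4 * (a₁ - ¾ * a₀) ≡ ι 4 * (ι 1 * (ι 1 * (a₁ - a₀) - 0ℚ) + 0ℚ) + a₀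
  identity = solve-∀ ℚ-ring

heunStencil-differences : ∀ x y a₀ a₁ a₂ d₁ d₂ →
  y ≡ 1ℚ + x → d₁ ≡ x * (a₁ - a₀) → d₂ ≡ y * (a₂ - a₁) →
  ι 4 * heunStencil x a₀ a₁ a₂ ≡ ι 4 * (y * (d₂ - d₁) + d₁) + a₁
heunStencil-differences x _ a₀ a₁ a₂ _ _ refl refl refl = identity x a₀ a₁ a₂
  where
  identity : ∀ x a₀ a₁ a₂ →
    ι 4 * ((1ℚ + x) * (1ℚ + x) * a₂ - (ι 2 * x * x + ι 2 * x + ¾) * a₁ + x * x * a₀)
      ≡ ι 4 * ((1ℚ + x) * ((1ℚ + x) * (a₂ - a₁) - x * (a₁ - a₀)) + x * (a₁ - a₀)) + a₁
  identity = solve-∀ ℚ-ring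

EulerRecurrence : (ℕ → ℚ) → (ℕ → ℚ) → Set
EulerRecurrence b c = ∀ k → ι 4 * (ι (suc k) * ι (suc k) * b (suc k)) + (ι 2 * ι k + 1ℚ) * (ι 2 * ι k + 1ℚ) * b k ≡ c k

binomialTransform-eulerRecurrence : ∀ {b c : ℕ → ℚ} → EulerRecurrence b c → ∀ n →
  let A = binomialTransform b ; D = binomialTransform (timesIndex b) in
  binomialTransform c n ≡ ι 4 * (ι (suc n) * (D (suc n) - D n) + D n) + A n
binomialTransform-eulerRecurrence {b} {c} recurrence n = begin
  binomialTransform c n
    ≡⟨ binomialTransform-cong (λ k → trans (sym (recurrence k)) (expand (ι (suc k)) (ι k) (b (suc k)) (b k))) n ⟩
  binomialTransform (λ k → ι 4 * (b₂ (suc k) + (b₂ k + b₁ k)) + b k) n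
    ≡⟨ binomialTransform-+ (λ k → ι 4 * (b₂ (suc k) + (b₂ k + b₁ k))) b n ⟩
  binomialTransform (λ k → ι 4 * (b₂ (suc k) + (b₂ k + b₁ k))) n + A n
    ≡⟨ cong (_+ A n) (binomialTransform-*ˡ (ι 4) (λ k → b₂ (suc k) + (b₂ k + b₁ k)) n) ⟩
  ι 4 * binomialTransform (λ k → b₂ (suc k) + (b₂ k + b₁ k)) n + A n
    ≡⟨ cong (λ z → ι 4 * z + A n) (trans (binomialTransform-+ (b₂ ∘ suc) (λ k → b₂ k + b₁ k) n)
                                           (cong (_+_ (binomialTransform (b₂ ∘ suc) n)) (binomialTransform-+ b₂ b₁ n))) ⟩
  ι 4 * (binomialTransform (b₂ ∘ suc) n + (Q n + D n)) + A n
    ≡⟨ cong (λ z → ι 4 * z + A n) (regroup (binomialTransform (b₂ ∘ suc) n) (Q n) (D n)) ⟩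
  ι 4 * (Q n + binomialTransform (b₂ ∘ suc) n + D n) + A n
    ≡⟨ cong (λ z → ι 4 * (z + D n) + A n) (binomialTransform-suc b₂ n) ⟨
  ι 4 * (Q (suc n) + D n) + A n
    ≡⟨ cong (λ z → ι 4 * (z + D n) + A n) (binomialTransform-timesIndex-difference b₁ n) ⟩
  ι 4 * (ι (suc n) * (D (suc n) - D n) + D n) + A n
    ∎
  where
  b₁ b₂ A D Q : ℕ → ℚ
  b₁ = timesIndex b
  b₂ = timesIndex b₁
  A = binomialTransform b
  D = binomialTransform b₁
  Q = binomialTransform b₂
  expand : ∀ s u x y → ι 4 * (s * s * x) + (ι 2 * u + 1ℚ) * (ι 2 * u + 1ℚ) * y
                     ≡ ι 4 * (s * (s * x) + (u * (u * y) + u * y)) + y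
  expand = solve-∀ ℚ-ring
  regroup : ∀ p q d → p + (q + d) ≡ q + p + d
  regroup = solve-∀ ℚ-ring

heunOp-binomialTransform : ∀ {b c : ℕ → ℚ} → EulerRecurrence b c →
  ∀ n → ι 4 * heunOp (binomialTransform b) n ≡ binomialTransform c n
heunOp-binomialTransform {b} {c} recurrence zero = begin
  ι 4 * heunOp A 0                         ≡⟨ cong (ι 4 *_) (heunOp-zero A) ⟩
  ι 4 * (A 1 - ¾ * A 0)                    ≡⟨ heunOp-zero-differences (A 0) (A 1) (D 0) (D 1)
                                                (binomialTransform-timesIndex-zero b) (binomialTransform-timesIndex-difference b 0) ⟩
  ι 4 * (ι 1 * (D 1 - D 0) + D 0) + A 0   ≡⟨ binomialTransform-eulerRecurrence recurrence 0 ⟨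
  binomialTransform c 0                    ∎
  where
  A D : ℕ → ℚ
  A = binomialTransform b
  D = binomialTransform (timesIndex b)
heunOp-binomialTransform {b} {c} recurrence (suc m) = begin
  ι 4 * heunOp A (suc m)
    ≡⟨ cong (ι 4 *_) (heunOp-suc A m) ⟩
  ι 4 * heunStencil (ι (suc m)) (A m) (A (suc m)) (A (suc (suc m)))
    ≡⟨ heunStencil-differences (ι (suc m)) (ι (suc (suc m))) (A m) (A (suc m)) (A (suc (suc m))) (D (suc m)) (D (suc (suc m)))
         (ι-suc (suc m)) (binomialTransform-timesIndex-difference b m) (binomialTransform-timesIndex-difference b (suc m)) ⟩
  ι 4 * (ι (suc (suc m)) * (D (suc (suc m)) - D (suc m)) + D (suc m)) + A (suc m)
    ≡⟨ binomialTransform-eulerRecurrence recurrence (suc m) ⟨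
  binomialTransform c (suc m)
    ∎
  where
  A D : ℕ → ℚ
  A = binomialTransform b
  D = binomialTransform (timesIndex b)

-- The explicit coefficients

binomMinusHalf : ℕ → ℚ
binomMinusHalf = gbinom (- ½)

oddCubeSummand : ℕ → ℚ
oddCubeSummand j = inv (powℚ (ι (2 ℕ.* j ℕ.+ 1)) 3) * inv (powℚ (binomMinusHalf j) 2)

formulaTerm : ℕ → ℚ
formulaTerm k = - ι 2 * (powℚ (- 1ℚ) k * powℚ (binomMinusHalf k) 2 * sumBelow k oddCubeSummand)

alternatingOddReciprocal : ℕ → ℚ
alternatingOddReciprocal k = powℚ (- 1ℚ) k * inv (ι (2 ℕ.* k ℕ.+ 1))

formulaCoeff-binomialTransform : ∀ n → formulaCoeff n ≡ binomialTransform formulaTerm n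
formulaCoeff-binomialTransform n =
  trans (sym (sumTo-*ˡ n (- ι 2) _)) (sumTo-cong n (λ k →
    regroup (- ι 2) (powℚ (- 1ℚ) k) (powℚ (binomMinusHalf k) 2) (binomℚ n k) (sumBelow k oddCubeSummand)))
  where
  regroup : ∀ c σ β b s → c * (σ * β * b * s) ≡ b * (c * (σ * β * s))
  regroup = solve-∀ ℚ-ring

binomMinusHalf-suc : ∀ k → ι 2 * ι (suc k) * binomMinusHalf (suc k) ≡ - (ι 2 * ι k + 1ℚ) * binomMinusHalf k
binomMinusHalf-suc k = begin
  ι 2 * ι (suc k) * binomMinusHalf (suc k)    ≡⟨ *-assoc (ι 2) (ι (suc k)) _ ⟩
  ι 2 * (ι (suc k) * binomMinusHalf (suc k))  ≡⟨ cong (ι 2 *_) (gbinom-suc (- ½) k) ⟩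
  ι 2 * ((- ½ - ι k) * binomMinusHalf k)      ≡⟨ identity (ι k) (binomMinusHalf k) ⟩
  - (ι 2 * ι k + 1ℚ) * binomMinusHalf k       ∎
  where
  identity : ∀ u c → ι 2 * ((- ½ - u) * c) ≡ - (ι 2 * u + 1ℚ) * c
  identity = solve-∀ ℚ-ring

binomMinusHalf≢0 : ∀ k → binomMinusHalf k ≢ 0ℚ
binomMinusHalf≢0 zero ()
binomMinusHalf≢0 (suc k) c≡0 = *-≢0 factor≢0 (binomMinusHalf≢0 k) (begin
  (- ½ - ι k) * binomMinusHalf k         ≡⟨ gbinom-suc (- ½) k ⟨
  ι (suc k) * binomMinusHalf (suc k)     ≡⟨ cong (ι (suc k) *_) c≡0 ⟩
  ι (suc k) * 0ℚ                         ≡⟨ *-zeroʳ (ι (suc k)) ⟩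
  0ℚ                                     ∎)
  where
  negated : ∀ u → ½ + u ≡ - (- ½ - u)
  negated = solve-∀ ℚ-ring
  factor≢0 : - ½ - ι k ≢ 0ℚ
  factor≢0 eq = positive+ι≢0 ½ k (trans (negated (ι k)) (cong -_ eq))

oddCubeSummand-weighted : ∀ k →
  (ι 2 * ι k + 1ℚ) * (ι 2 * ι k + 1ℚ) * powℚ (binomMinusHalf k) 2 * oddCubeSummand k ≡ inv (ι (2 ℕ.* k ℕ.+ 1))
oddCubeSummand-weighted k = begin
  (ι 2 * ι k + 1ℚ) * (ι 2 * ι k + 1ℚ) * powℚ c 2 * oddCubeSummand k
    ≡⟨ cong₂ (λ t s → t * t * powℚ c 2 * s) (sym (ι-odd k)) (cong₂ _*_ (inv-powℚ o 3) (inv-powℚ c 2)) ⟩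
  o * o * powℚ c 2 * (powℚ (inv o) 3 * powℚ (inv c) 2)
    ≡⟨ regroup o c (inv o) (inv c) ⟩
  o * inv o * (o * inv o) * (c * inv c * (c * inv c)) * inv o
    ≡⟨ cong₂ (λ s t → s * s * (t * t) * inv o) (inv-inverseʳ (ι-odd≢0 k)) (inv-inverseʳ (binomMinusHalf≢0 k)) ⟩
  1ℚ * inv o
    ≡⟨ *-identityˡ (inv o) ⟩
  inv o
    ∎
  where
  o c : ℚ
  o = ι (2 ℕ.* k ℕ.+ 1)
  c = binomMinusHalf k
  regroup : ∀ o c p q → o * o * (1ℚ * c * c) * ((1ℚ * p * p * p) * (1ℚ * q * q)) ≡ o * p * (o * p) * (c * q * (c * q)) * p
  regroup = solve-∀ ℚ-ring

-- The weights of the partial sums agree by binomMinusHalf-suc, so only the new summand survives.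
formulaTerm-eulerRecurrence : EulerRecurrence formulaTerm (λ k → ι 2 * alternatingOddReciprocal k)
formulaTerm-eulerRecurrence k = begin
  ι 4 * (s * s * formulaTerm (suc k)) + t * t * formulaTerm k
    ≡⟨ expand σ t s c c′ S F ⟩
  ι 2 * σ * ((ι 2 * s * c′) * (ι 2 * s * c′) * (S + F) - t * t * (c * c) * S)
    ≡⟨ cong (λ p → ι 2 * σ * (p * p * (S + F) - t * t * (c * c) * S)) (binomMinusHalf-suc k) ⟩
  ι 2 * σ * ((- t * c) * (- t * c) * (S + F) - t * t * (c * c) * S)
    ≡⟨ telescope σ t c S F ⟩
  ι 2 * (σ * (t * t * powℚ c 2 * F))
    ≡⟨ cong (λ z → ι 2 * (σ * z)) (oddCubeSummand-weighted k) ⟩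
  ι 2 * alternatingOddReciprocal k
    ∎
  where
  σ t s c c′ S F : ℚ
  σ = powℚ (- 1ℚ) k
  t = ι 2 * ι k + 1ℚ
  s = ι (suc k)
  c = binomMinusHalf k
  c′ = binomMinusHalf (suc k)
  S = sumBelow k oddCubeSummand
  F = oddCubeSummand k
  expand : ∀ σ t s c c′ S F →
    ι 4 * (s * s * (- ι 2 * ((σ * - 1ℚ) * (1ℚ * c′ * c′) * (S + F)))) + t * t * (- ι 2 * (σ * (1ℚ * c * c) * S))
      ≡ ι 2 * σ * ((ι 2 * s * c′) * (ι 2 * s * c′) * (S + F) - t * t * (c * c) * S)
  expand = solve-∀ ℚ-ring
  telescope : ∀ σ t c S F →
    ι 2 * σ * ((- t * c) * (- t * c) * (S + F) - t * t * (c * c) * S) ≡ ι 2 * (σ * (t * t * (1ℚ * c * c) * F))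
  telescope = solve-∀ ℚ-ring

-- The hypergeometric right-hand side

hyp2F1-ratio : ∀ a b c n → c + ι n ≢ 0ℚ →
  (c + ι n) * ι (suc n) * hyp2F1 a b c (suc n) ≡ (a + ι n) * (b + ι n) * hyp2F1 a b c n
hyp2F1-ratio a b c n c+n≢0 = begin
  s * (numerator * inv ((poch c n * (c + ι n)) * (factℚ n * ι (suc n))))
    ≡⟨ cong (λ d → s * (numerator * inv d)) (regroup (poch c n) (c + ι n) (factℚ n) (ι (suc n))) ⟩
  s * (numerator * inv (poch c n * factℚ n * s))
    ≡⟨ cancel-inv-factor numerator (poch c n * factℚ n) (*-≢0 c+n≢0 (ι≢0 (suc n))) ⟩
  numerator * inv (poch c n * factℚ n)
    ≡⟨ extract (poch a n) (poch b n) (a + ι n) (b + ι n) (inv (poch c n * factℚ n)) ⟩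
  (a + ι n) * (b + ι n) * hyp2F1 a b c n
    ∎
  where
  s numerator : ℚ
  s = (c + ι n) * ι (suc n)
  numerator = poch a n * (a + ι n) * (poch b n * (b + ι n))
  regroup : ∀ p c f i → p * c * (f * i) ≡ p * f * (c * i)
  regroup = solve-∀ ℚ-ring
  extract : ∀ p q a b r → p * a * (q * b) * r ≡ a * b * (p * q * r)
  extract = solve-∀ ℚ-ring

firstOrder-proportional : ∀ (α β : ℕ → ℚ) {X Y : ℕ → ℚ} c → (∀ n → α n ≢ 0ℚ) →
  (∀ n → α n * X (suc n) ≡ β n * X n) → (∀ n → α n * Y (suc n) ≡ β n * Y n) →
  X 0 ≡ c * Y 0 → ∀ n → X n ≡ c * Y n
firstOrder-proportional α β c α≢0 recX recY X₀ zero    = X₀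
firstOrder-proportional α β {X} {Y} c α≢0 recX recY X₀ (suc n) = *-cancelˡ-≢0 (α≢0 n) (begin
  α n * X (suc n)        ≡⟨ recX n ⟩
  β n * X n              ≡⟨ cong (β n *_) (firstOrder-proportional α β c α≢0 recX recY X₀ n) ⟩
  β n * (c * Y n)        ≡⟨ swap (β n) c (Y n) ⟩
  c * (β n * Y n)        ≡⟨ cong (c *_) (recY n) ⟨
  c * (α n * Y (suc n))  ≡⟨ swap c (α n) (Y (suc n)) ⟩
  α n * (c * Y (suc n))  ∎)
  where
  swap : ∀ a b x → a * (b * x) ≡ b * (a * x)
  swap = solve-∀ ℚ-ring

hyp : ℕ → ℚ
hyp = hyp2F1 1ℚ 1ℚ (+ 3 / 2)

HypRatio : (ℕ → ℚ) → Set
HypRatio X = ∀ n → (+ 3 / 2 + ι n) * ι (suc n) * X (suc n) ≡ (1ℚ + ι n) * (1ℚ + ι n) * X n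

hyp-unique : ∀ {X} c → HypRatio X → X 0 ≡ c * hyp 0 → ∀ n → X n ≡ c * hyp n
hyp-unique c ratio =
  firstOrder-proportional (λ n → (+ 3 / 2 + ι n) * ι (suc n)) (λ n → (1ℚ + ι n) * (1ℚ + ι n)) c
    (λ n → *-≢0 (positive+ι≢0 (+ 3 / 2) n) (ι≢0 (suc n)))
    ratio (λ n → hyp2F1-ratio 1ℚ 1ℚ (+ 3 / 2) n (positive+ι≢0 (+ 3 / 2) n))

OddRatio : (ℕ → ℚ) → Set
OddRatio X = ∀ n → (ι 2 * ι (suc n) + 1ℚ) * X (suc n) ≡ ι 2 * ι (suc n) * X n

OddRatio⇒HypRatio : ∀ {X} → OddRatio X → HypRatio X
OddRatio⇒HypRatio {X} odd n = rescale (ι (suc n)) (ι n) (X (suc n)) (X n) (ι-suc n) (odd n)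
  where
  rescale : ∀ x u a b → x ≡ 1ℚ + u →
    (ι 2 * x + 1ℚ) * a ≡ ι 2 * x * b → (+ 3 / 2 + u) * x * a ≡ (1ℚ + u) * (1ℚ + u) * b
  rescale _ u a b refl eq = begin
    (+ 3 / 2 + u) * (1ℚ + u) * a                  ≡⟨ half u a ⟩
    ½ * (1ℚ + u) * ((ι 2 * (1ℚ + u) + 1ℚ) * a)    ≡⟨ cong (½ * (1ℚ + u) *_) eq ⟩
    ½ * (1ℚ + u) * (ι 2 * (1ℚ + u) * b)           ≡⟨ halve (1ℚ + u) b ⟩
    (1ℚ + u) * (1ℚ + u) * b                        ∎
    where
    half : ∀ u a → (+ 3 / 2 + u) * (1ℚ + u) * a ≡ ½ * (1ℚ + u) * ((ι 2 * (1ℚ + u) + 1ℚ) * a)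
    half = solve-∀ ℚ-ring
    halve : ∀ x b → ½ * x * (ι 2 * x * b) ≡ x * x * b
    halve = solve-∀ ℚ-ring

binomialTransform-alternating : ∀ n → binomialTransform (powℚ (- 1ℚ)) (suc n) ≡ 0ℚ
binomialTransform-alternating n = begin
  binomialTransform σ (suc n)                            ≡⟨ binomialTransform-suc σ n ⟩
  binomialTransform σ n + binomialTransform (σ ∘ suc) n  ≡⟨ cong (_+_ (binomialTransform σ n)) shifted ⟩
  binomialTransform σ n + - 1ℚ * binomialTransform σ n   ≡⟨ cancel (binomialTransform σ n) ⟩
  0ℚ                                                     ∎
  where
  σ : ℕ → ℚ
  σ = powℚ (- 1ℚ)
  shifted : binomialTransform (σ ∘ suc) n ≡ - 1ℚ * binomialTransform σ n
  shifted = trans (binomialTransform-cong (λ k → *-comm (σ k) (- 1ℚ)) n) (binomialTransform-*ˡ (- 1ℚ) σ n)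
  cancel : ∀ x → x + - 1ℚ * x ≡ 0ℚ
  cancel = solve-∀ ℚ-ring

alternatingOddReciprocal-weighted : ∀ k → (ι 2 * ι k + 1ℚ) * alternatingOddReciprocal k ≡ powℚ (- 1ℚ) k
alternatingOddReciprocal-weighted k = begin
  (ι 2 * ι k + 1ℚ) * (σ * inv o)  ≡⟨ cong (_* (σ * inv o)) (ι-odd k) ⟨
  o * (σ * inv o)                 ≡⟨ swap o σ (inv o) ⟩
  σ * (o * inv o)                 ≡⟨ cong (σ *_) (inv-inverseʳ (ι-odd≢0 k)) ⟩
  σ * 1ℚ                          ≡⟨ *-identityʳ σ ⟩
  σ                               ∎
  where
  σ o : ℚ
  σ = powℚ (- 1ℚ) k
  o = ι (2 ℕ.* k ℕ.+ 1)
  swap : ∀ a b c → a * (b * c) ≡ b * (a * c)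
  swap = solve-∀ ℚ-ring

binomialTransform-alternatingOddReciprocal-oddRatio : OddRatio (binomialTransform alternatingOddReciprocal)
binomialTransform-alternatingOddReciprocal-oddRatio n = solve-for (ι (suc n)) (G (suc n)) (G n) (begin
  ι 2 * (ι (suc n) * (G (suc n) - G n)) + G (suc n)
    ≡⟨ cong (λ d → ι 2 * d + G (suc n)) (binomialTransform-timesIndex-difference g n) ⟨
  ι 2 * binomialTransform (timesIndex g) (suc n) + G (suc n)
    ≡⟨ cong (_+ G (suc n)) (binomialTransform-*ˡ (ι 2) (timesIndex g) (suc n)) ⟨
  binomialTransform (λ k → ι 2 * timesIndex g k) (suc n) + G (suc n)
    ≡⟨ binomialTransform-+ (λ k → ι 2 * timesIndex g k) g (suc n) ⟨
  binomialTransform (λ k → ι 2 * timesIndex g k + g k) (suc n)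
    ≡⟨ binomialTransform-cong split (suc n) ⟨
  binomialTransform (powℚ (- 1ℚ)) (suc n)
    ≡⟨ binomialTransform-alternating n ⟩
  0ℚ
    ∎)
  where
  g G : ℕ → ℚ
  g = alternatingOddReciprocal
  G = binomialTransform g
  split : ∀ k → powℚ (- 1ℚ) k ≡ ι 2 * timesIndex g k + g k
  split k = trans (sym (alternatingOddReciprocal-weighted k)) (distribute (ι k) (g k))
    where
    distribute : ∀ u g → (ι 2 * u + 1ℚ) * g ≡ ι 2 * (u * g) + g
    distribute = solve-∀ ℚ-ring
  solve-for : ∀ x a b → ι 2 * (x * (a - b)) + a ≡ 0ℚ → (ι 2 * x + 1ℚ) * a ≡ ι 2 * x * b
  solve-for x a b eq = begin
    (ι 2 * x + 1ℚ) * a                       ≡⟨ shuffle x a b ⟩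
    (ι 2 * (x * (a - b)) + a) + ι 2 * x * b  ≡⟨ cong (_+ ι 2 * x * b) eq ⟩
    0ℚ + ι 2 * x * b                         ≡⟨ +-identityˡ (ι 2 * x * b) ⟩
    ι 2 * x * b                              ∎
    where
    shuffle : ∀ x a b → (ι 2 * x + 1ℚ) * a ≡ (ι 2 * (x * (a - b)) + a) + ι 2 * x * b
    shuffle = solve-∀ ℚ-ring

binomialTransform-alternatingOddReciprocal : ∀ n → binomialTransform alternatingOddReciprocal n ≡ hyp n
binomialTransform-alternatingOddReciprocal n =
  trans (hyp-unique 1ℚ (OddRatio⇒HypRatio binomialTransform-alternatingOddReciprocal-oddRatio) refl n)
        (*-identityˡ (hyp n))

J̃₃-source : ℕ → ℚ
J̃₃-source n = powℚ (ι 2) (suc n) * factℚ n * inv (oddDoubleFact (suc n))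

J̃₃-source-oddRatio : OddRatio J̃₃-source
J̃₃-source-oddRatio n = begin
  (ι 2 * ι (suc n) + 1ℚ) * J̃₃-source (suc n)
    ≡⟨ cong (_* J̃₃-source (suc n)) (ι-odd (suc n)) ⟨
  ι (2 ℕ.* suc n ℕ.+ 1) * (p * ι 2 * (factℚ n * ι (suc n)) * inv (oddDoubleFact (suc n) * ι (2 ℕ.* suc n ℕ.+ 1)))
    ≡⟨ cancel-inv-factor (p * ι 2 * (factℚ n * ι (suc n))) (oddDoubleFact (suc n)) (ι-odd≢0 (suc n)) ⟩
  p * ι 2 * (factℚ n * ι (suc n)) * inv (oddDoubleFact (suc n))
    ≡⟨ regroup p (factℚ n) (ι (suc n)) (inv (oddDoubleFact (suc n))) ⟩
  ι 2 * ι (suc n) * J̃₃-source n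
    ∎
  where
  p : ℚ
  p = powℚ (ι 2) (suc n)
  regroup : ∀ p f x r → p * ι 2 * (f * x) * r ≡ ι 2 * x * (p * f * r)
  regroup = solve-∀ ℚ-ring

J̃₃-source-hyp : ∀ n → J̃₃-source n ≡ ι 2 * hyp n
J̃₃-source-hyp = hyp-unique (ι 2) (OddRatio⇒HypRatio J̃₃-source-oddRatio) refl

J̃₃-recurrence : ∀ m → let x = ι (suc m) ; y = ι (suc (suc m)) in
  ι 4 * y * y * J̃₃ (suc (suc m)) ≡ J̃₃-source (suc m) + (ι 8 * y * x + ι 3) * J̃₃ (suc m) - ι 4 * x * x * J̃₃ m
J̃₃-recurrence m = begin
  ι 4 * ι N * ι N * J̃₃ N
    ≡⟨ cong (_* J̃₃ N) (ι-4*n*n N) ⟨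
  ι (4 ℕ.* N ℕ.* N) * (inv (ι (4 ℕ.* N ℕ.* N)) * rhs)
    ≡⟨ inv-cancelʳ (ι≢0 (4 ℕ.* N ℕ.* N)) rhs ⟩
  rhs
    ≡⟨ cong₂ (λ p q → J̃₃-source (suc m) + p * J̃₃ (suc m) - q * J̃₃ m) middle (ι-4*n*n (suc m)) ⟩
  J̃₃-source (suc m) + (ι 8 * ι N * ι (suc m) + ι 3) * J̃₃ (suc m) - ι 4 * ι (suc m) * ι (suc m) * J̃₃ m
    ∎
  where
  ι-4*n*n : ∀ n → ι (4 ℕ.* n ℕ.* n) ≡ ι 4 * ι n * ι n
  ι-4*n*n n = trans (ι-* (4 ℕ.* n) n) (cong (_* ι n) (ι-* 4 n))
  N : ℕ
  N = suc (suc m)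
  rhs : ℚ
  rhs = J̃₃-source (suc m) + ι (8 ℕ.* N ℕ.* N ℕ.∸ 8 ℕ.* N ℕ.+ 3) * J̃₃ (suc m)
        - ι (4 ℕ.* suc m ℕ.* suc m) * J̃₃ m
  8N*N∸8N : 8 ℕ.* N ℕ.* N ℕ.∸ 8 ℕ.* N ≡ 8 ℕ.* N ℕ.* suc m
  8N*N∸8N = trans (cong (ℕ._∸ 8 ℕ.* N) (ℕ.*-suc (8 ℕ.* N) (suc m))) (ℕ.m+n∸m≡n (8 ℕ.* N) (8 ℕ.* N ℕ.* suc m))
  middle : ι (8 ℕ.* N ℕ.* N ℕ.∸ 8 ℕ.* N ℕ.+ 3) ≡ ι 8 * ι N * ι (suc m) + ι 3
  middle = begin
    ι (8 ℕ.* N ℕ.* N ℕ.∸ 8 ℕ.* N ℕ.+ 3)   ≡⟨ cong (λ k → ι (k ℕ.+ 3)) 8N*N∸8N ⟩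
    ι (8 ℕ.* N ℕ.* suc m ℕ.+ 3)           ≡⟨ ι-+ (8 ℕ.* N ℕ.* suc m) 3 ⟩
    ι (8 ℕ.* N ℕ.* suc m) + ι 3           ≡⟨ cong (_+ ι 3) (trans (ι-* (8 ℕ.* N) (suc m)) (cong (_* ι (suc m)) (ι-* 8 N))) ⟩
    ι 8 * ι N * ι (suc m) + ι 3           ∎

heunStencil-recurrence : ∀ x y a b c e → y ≡ 1ℚ + x →
  ι 4 * y * y * c ≡ e + (ι 8 * y * x + ι 3) * b - ι 4 * x * x * a → ι 4 * heunStencil x a b c ≡ e
heunStencil-recurrence x _ a b c e refl eq = begin
  ι 4 * heunStencil x a b c
    ≡⟨ expand x a b c ⟩
  ι 4 * (1ℚ + x) * (1ℚ + x) * c - (ι 8 * (1ℚ + x) * x + ι 3) * b + ι 4 * x * x * a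
    ≡⟨ cong (λ z → z - (ι 8 * (1ℚ + x) * x + ι 3) * b + ι 4 * x * x * a) eq ⟩
  e + (ι 8 * (1ℚ + x) * x + ι 3) * b - ι 4 * x * x * a - (ι 8 * (1ℚ + x) * x + ι 3) * b + ι 4 * x * x * a
    ≡⟨ collapse x a b e ⟩
  e ∎
  where
  expand : ∀ x a b c → ι 4 * ((1ℚ + x) * (1ℚ + x) * c - (ι 2 * x * x + ι 2 * x + ¾) * b + x * x * a)
    ≡ ι 4 * (1ℚ + x) * (1ℚ + x) * c - (ι 8 * (1ℚ + x) * x + ι 3) * b + ι 4 * x * x * a
  expand = solve-∀ ℚ-ring
  collapse : ∀ x a b e →
    e + (ι 8 * (1ℚ + x) * x + ι 3) * b - ι 4 * x * x * a - (ι 8 * (1ℚ + x) * x + ι 3) * b + ι 4 * x * x * a ≡ e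
  collapse = solve-∀ ℚ-ring

solvesHeun : ∀ {w : Series} → (∀ n → ι 4 * heunOp w n ≡ ι 2 * hyp n) → ∀ n → heunOp w n ≡ heunRHS n
solvesHeun {w} quadrupled n = begin
  heunOp w n                    ≡⟨ quarter (heunOp w n) ⟩
  + 1 / 4 * (ι 4 * heunOp w n)  ≡⟨ cong (+ 1 / 4 *_) (quadrupled n) ⟩
  + 1 / 4 * (ι 2 * hyp n)       ≡⟨ halve (hyp n) ⟩
  heunRHS n                     ∎
  where
  quarter : ∀ h → h ≡ + 1 / 4 * (ι 4 * h)
  quarter = solve-∀ ℚ-ring
  halve : ∀ h → + 1 / 4 * (ι 2 * h) ≡ ½ * h
  halve = solve-∀ ℚ-ring

formulaCoeff-solvesHeun : ∀ n → heunOp formulaCoeff n ≡ heunRHS n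
formulaCoeff-solvesHeun = solvesHeun λ n → begin
  ι 4 * heunOp formulaCoeff n
    ≡⟨ cong (ι 4 *_) (heunOp-cong formulaCoeff-binomialTransform n) ⟩
  ι 4 * heunOp (binomialTransform formulaTerm) n
    ≡⟨ heunOp-binomialTransform formulaTerm-eulerRecurrence n ⟩
  binomialTransform (λ k → ι 2 * alternatingOddReciprocal k) n
    ≡⟨ binomialTransform-*ˡ (ι 2) alternatingOddReciprocal n ⟩
  ι 2 * binomialTransform alternatingOddReciprocal n
    ≡⟨ cong (ι 2 *_) (binomialTransform-alternatingOddReciprocal n) ⟩
  ι 2 * hyp n
    ∎

J̃₃-solvesHeun : ∀ n → heunOp J̃₃ n ≡ heunRHS n
J̃₃-solvesHeun = solvesHeun quadrupled
  where
  quadrupled : ∀ n → ι 4 * heunOp J̃₃ n ≡ ι 2 * hyp n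
  quadrupled zero    = refl
  quadrupled (suc m) = begin
    ι 4 * heunOp J̃₃ (suc m)
      ≡⟨ cong (ι 4 *_) (heunOp-suc J̃₃ m) ⟩
    ι 4 * heunStencil (ι (suc m)) (J̃₃ m) (J̃₃ (suc m)) (J̃₃ (suc (suc m)))
      ≡⟨ heunStencil-recurrence (ι (suc m)) (ι (suc (suc m))) _ _ _ _ (ι-suc (suc m)) (J̃₃-recurrence m) ⟩
    J̃₃-source (suc m)
      ≡⟨ J̃₃-source-hyp (suc m) ⟩
    ι 2 * hyp (suc m)
      ∎

theorem4p3 : ((∀ n → heunOp formulaCoeff n ≡ heunRHS n) × formulaCoeff 0 ≡ 0ℚ)
    × (∀ (w : Series) → (∀ n → heunOp w n ≡ heunRHS n) → w 0 ≡ 0ℚ → ∀ n → w n ≡ formulaCoeff n)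
    × (∀ n → J̃₃ n ≡ formulaCoeff n)
theorem4p3 = (formulaCoeff-solvesHeun , refl) , unique , unique J̃₃ J̃₃-solvesHeun refl
  where
  unique : ∀ (w : Series) → (∀ n → heunOp w n ≡ heunRHS n) → w 0 ≡ 0ℚ → ∀ n → w n ≡ formulaCoeff n
  unique w w-solves w₀ = heunOp-unique (λ n → trans (w-solves n) (sym (formulaCoeff-solvesHeun n))) w₀
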